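{- Let $n\ge 0$ and $k\ge 1$ be integers. Then \[ D(n,k) = \sum_{m_k=0}^{U_k} \sum_{m_{k-1}=0}^{U_{k-1}} \cdots \sum_{m_2=0}^{U_2} \Bigl( 1+n-k^2 - \sum_{h=2}^k h m_h \Bigr) \prod_{i=2}^k (m_i + 1), \] where for $j=2,3,\dots,k$, \[ U_j = \left\lfloor \frac{ n-k^2 - \sum_{h=j+1}^k h m_h}{j} \right\rfloor . \] A sum whose upper limit is smaller than its lower limit is empty, and equals $0$. When $k=1$ the multisum has no summation variables and consists of the single term $1+n-1$.
   Context: A partition of $n$ is a nonincreasing finite sequence of positive integers summing to $n$. The Durfee square of a partition $\lambda$ is the largest square of dots, with its corner at the upper left, contained in its Ferrers graph. Its order $k$ is the largest $k$ with $\lambda_k\ge k$. $D(n,k)$ denotes the number of partitions of $n$ whose Durfee square has order $k$. -}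

module Defs where

open import Data.Nat using (ℕ; zero; suc; _+_; _*_; _∸_; _≤_; _<_; _≥_; _/_)
open import Data.List using (List; []; _∷_; map; upTo)
open import Data.Nat.ListAction using (sum)
open import Data.List.Relation.Unary.All using (All)
open import Data.List.Relation.Unary.Linked using (Linked)
open import Data.Product using (_×_)
open import Data.Sum using (_⊎_)
open import Relation.Binary.PropositionalEquality using (_≡_)
open import Relation.Nullary.Decidable using (⌊_⌋)
open import Data.Bool using (if_then_else_)
open import Data.Nat using (_≤?_)

IsPartition : ℕ → List ℕ → Set
IsPartition n λs = All (λ x → 1 ≤ x) λs × Linked _≥_ λs × sum λs ≡ n

-- 1-based part: part λ (suc i) = λ_{i+1}; out of range (or index 0) gives 0.
part : List ℕ → ℕ → ℕ
part []       _             = 0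
part (x ∷ xs) zero          = 0
part (x ∷ xs) (suc zero)    = x
part (x ∷ xs) (suc (suc i)) = part xs (suc i)

-- k is the order of the Durfee square of λ: the largest k with λ_k ≥ k
-- (k = 0 when no such positive k exists).
DurfeeOrder : List ℕ → ℕ → Set
DurfeeOrder λs k = (k ≡ 0 ⊎ k ≤ part λs k) × (∀ j → k < j → part λs j < j)

sumTo : ℕ → (ℕ → ℕ) → ℕ
sumTo U f = sum (map f (upTo (suc U)))

-- inner j r p : the nested sum over m_j, ..., m_2 (for j ≥ 2) where
--   r = n - k² - Σ_{h=j+1}^k h m_h  (the remaining budget, always ≥ 0 here),
--   p = Π_{i=j+1}^k (m_i + 1)       (the product accumulated so far),
-- with U_j = ⌊ r / j ⌋ and the summand (1 + r_final) * product.
-- inner 1 r p is the innermost term (1 + n - k² - Σ_{h=2}^k h m_h) Π_{i=2}^k (m_i+1).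
inner : ℕ → ℕ → ℕ → ℕ
inner zero          r p = (1 + r) * p
inner (suc zero)    r p = (1 + r) * p
inner (suc (suc j)) r p =
  sumTo (r / suc (suc j)) (λ m → inner (suc j) (r ∸ suc (suc j) * m) (p * (m + 1)))

-- The right-hand side multisum.  If n < k², then U_k < 0 (for k ≥ 2), so the
-- outermost sum is empty, and for k = 1 the single term is 1 + n - 1 = 0 (n = 0).
-- Either way the value is 0.
durfeeFormula : ℕ → ℕ → ℕ
durfeeFormula n k = if ⌊ k * k ≤? n ⌋ then inner k (n ∸ k * k) 1 else 0

module Submission where

-- A partition with Durfee square of order k is a
-- k × k square together with a partition R with at most k rows to its right
-- and a partition B with parts ≤ k below it.  Record, for each i ≤ k, the
-- number a_i of columns of height i in R and the number b_i of parts i in B: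
-- the partition is determined by the "profile" ((a_k , b_k) , … , (a_1 , b_1)),
-- any profile occurs, and its size is k² + Σ i (a_i + b_i).  With m_i = a_i + b_i,
-- each choice of m_k, …, m_2 within the bounds U_j leaves m_1 determined and
-- m_i + 1 ways to split each m_i, which is the summand of the multisum.

open import Data.Nat using (ℕ; zero; suc; _+_; _*_; _∸_; _≤_; _<_; _≥_; _/_; z≤n; s≤s; _≤?_; _≟_; NonZero)
open import Data.Nat.Properties
open import Data.Nat.DivMod using (m*n/n≡m; /-monoˡ-≤; m/n*n≤m)
open import Data.Nat.ListAction using (sum)
open import Data.Nat.ListAction.Properties using (sum-++)
open import Data.Nat.Tactic.RingSolver using (solve-∀)
open import Data.List using (List; []; _∷_; [_]; _++_; map; concatMap; upTo; length; replicate)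
open import Data.List.Properties
  using (length-++; length-map; map-cong; length-upTo; ∷-injective; ∷-injectiveʳ; ∷ʳ-injective; map-injective)
open import Data.List.Membership.Propositional using (_∈_; find; lose)
open import Data.List.Membership.Propositional.Properties
  using (∈-map⁺; ∈-map⁻; ∈-concatMap⁺; ∈-concatMap⁻; ∈-upTo⁺; ∈-upTo⁻; map∷⁻)
open import Data.List.Relation.Unary.All using (All; []; _∷_)
import Data.List.Relation.Unary.All as All
import Data.List.Relation.Unary.All.Properties as All
open import Data.List.Relation.Unary.Any using (here; there)
open import Data.List.Relation.Unary.Unique.Propositional using (Unique)
import Data.List.Relation.Unary.Unique.Propositional.Properties as Unique
open import Data.List.Relation.Unary.AllPairs using ([]; _∷_)
open import Data.List.Relation.Unary.Linked using (Linked; []; [-]; _∷_)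
import Data.List.Relation.Unary.Linked as Linked
import Data.List.Relation.Unary.Linked.Properties as Linked
open import Data.Product using (_×_; _,_; proj₁; proj₂; ∃-syntax)
open import Data.Sum using (inj₂)
open import Function.Bundles using (_⇔_; mk⇔)
open import Relation.Binary.PropositionalEquality hiding ([_])
open import Relation.Nullary using (¬_; yes; no; contradiction)
open import Defs

length-concatMap : ∀ {A B : Set} (f : A → List B) xs →
  length (concatMap f xs) ≡ sum (map (λ x → length (f x)) xs)
length-concatMap f []       = refl
length-concatMap f (x ∷ xs) =
  trans (length-++ (f x)) (cong (length (f x) +_) (length-concatMap f xs))

length-concatMap-map : ∀ {A B C : Set} (g : A → B → C) xs ys →
  length (concatMap (λ x → map (g x) ys) xs) ≡ length xs * length ys
length-concatMap-map g []       ys = refl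
length-concatMap-map g (x ∷ xs) ys = trans (length-++ (map (g x) ys))
  (cong₂ _+_ (length-map (g x) ys) (length-concatMap-map g xs ys))

*-sum-map : ∀ {A : Set} p (f : A → ℕ) xs →
  p * sum (map f xs) ≡ sum (map (λ x → p * f x) xs)
*-sum-map p f []       = *-zeroʳ p
*-sum-map p f (x ∷ xs) =
  trans (*-distribˡ-+ p (f x) _) (cong (p * f x +_) (*-sum-map p f xs))

Unique-concatMap : ∀ {A B : Set} (f : A → List B) (key : B → A) →
  (∀ x {y} → y ∈ f x → key y ≡ x) → (∀ x → Unique (f x)) →
  ∀ {xs} → Unique xs → Unique (concatMap f xs)
Unique-concatMap f key keyed uf {[]}     []         = []
Unique-concatMap f key keyed uf {x ∷ xs} (x∉ ∷ uxs) =
  Unique.++⁺ (uf x) (Unique-concatMap f key keyed uf uxs) disjoint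
  where
  disjoint : ∀ {y} → ¬ (y ∈ f x × y ∈ concatMap f xs)
  disjoint (y∈fx , y∈rest) with find (∈-concatMap⁻ f {xs} y∈rest)
  ... | x′ , x′∈xs , y∈fx′ = All.lookup x∉ x′∈xs (trans (sym (keyed x y∈fx)) (keyed x′ y∈fx′))

Unique-map-on : ∀ {A B : Set} (f : A → B) {xs} → Unique xs →
  (∀ {x y} → x ∈ xs → y ∈ xs → f x ≡ f y → x ≡ y) → Unique (map f xs)
Unique-map-on f {[]}     []         inj = []
Unique-map-on f {x ∷ xs} (x∉ ∷ uxs) inj =
  All.map⁺ (All.tabulate (λ y∈ fx≡fy → All.lookup x∉ y∈ (inj (here refl) (there y∈) fx≡fy)))
  ∷ Unique-map-on f uxs (λ x∈ y∈ → inj (there x∈) (there y∈))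

-- A profile (a_j , b_j) ∷ … ∷ (a_1 , b_1) records, for each size i ≤ j, how many
-- columns (a_i) and how many rows (b_i) of length i a partition with Durfee
-- square of order j has outside its square; m_i = a_i + b_i as in the formula.
Profile : Set
Profile = List (ℕ × ℕ)

-- The number of cells outside the square: Σ_i i · (a_i + b_i).
weight : Profile → ℕ
weight []             = 0
weight ((a , b) ∷ ps) = (a + b) * suc (length ps) + weight ps

pairsSumming : ℕ → List (ℕ × ℕ)
pairsSumming m = map (λ a → (a , m ∸ a)) (upTo (suc m))

length-pairsSumming : ∀ m → length (pairsSumming m) ≡ suc m
length-pairsSumming m = trans (length-map _ (upTo (suc m))) (length-upTo (suc m))

Unique-pairsSumming : ∀ m → Unique (pairsSumming m)
Unique-pairsSumming m = Unique.map⁺ (cong proj₁) (Unique.upTo⁺ (suc m))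

∈-pairsSumming⁻ : ∀ {m a b} → (a , b) ∈ pairsSumming m → a + b ≡ m
∈-pairsSumming⁻ {m} ab∈ with ∈-map⁻ (λ a → (a , m ∸ a)) ab∈
... | a , a∈ , refl = m+[n∸m]≡n (≤-pred (∈-upTo⁻ a∈))

∈-pairsSumming⁺ : ∀ a b → (a , b) ∈ pairsSumming (a + b)
∈-pairsSumming⁺ a b = subst (λ c → (a , c) ∈ pairsSumming (a + b)) (m+n∸m≡n a b)
  (∈-map⁺ (λ c → (c , a + b ∸ c)) (∈-upTo⁺ (s≤s (m≤m+n a b))))

-- profiles j r lists the profiles of length 1 + j and weight r, following the
-- nesting of the multisum: the outer index is m = a + b of the head pair,
-- which ranges up to ⌊ r / (2 + j) ⌋.
profiles : ℕ → ℕ → List Profile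
profilesWithHead : ℕ → ℕ → ℕ → List Profile
profiles zero    r = map [_] (pairsSumming r)
profiles (suc j) r = concatMap (profilesWithHead j r) (upTo (suc (r / suc (suc j))))

profilesWithHead j r m =
  concatMap (λ ab → map (ab ∷_) (profiles j (r ∸ suc (suc j) * m))) (pairsSumming m)

-- Counting: p · #profiles j r is the multisum with accumulated product p.
-- Carrying p through the induction is what makes the nested product match.
count-profiles : ∀ j r p → p * length (profiles j r) ≡ inner (suc j) r p
count-profiles zero r p = begin
  p * length (map [_] (pairsSumming r))
    ≡⟨ cong (p *_) (trans (length-map [_] (pairsSumming r)) (length-pairsSumming r)) ⟩
  p * suc r
    ≡⟨ *-comm p (suc r) ⟩
  suc r * p
    ∎
  where open ≡-Reasoning
count-profiles (suc j) r p = begin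
  p * length (concatMap (profilesWithHead j r) ms)
    ≡⟨ cong (p *_) (length-concatMap (profilesWithHead j r) ms) ⟩
  p * sum (map (λ m → length (profilesWithHead j r m)) ms)
    ≡⟨ *-sum-map p _ ms ⟩
  sum (map (λ m → p * length (profilesWithHead j r m)) ms)
    ≡⟨ cong sum (map-cong headTerm ms) ⟩
  sum (map (λ m → inner (suc j) (r ∸ suc (suc j) * m) (p * (m + 1))) ms)
    ∎
  where
  open ≡-Reasoning
  ms = upTo (suc (r / suc (suc j)))
  headTerm : ∀ m → p * length (profilesWithHead j r m)
                 ≡ inner (suc j) (r ∸ suc (suc j) * m) (p * (m + 1))
  headTerm m = begin
    p * length (profilesWithHead j r m)
      ≡⟨ cong (p *_) (length-concatMap-map _∷_ (pairsSumming m) rest) ⟩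
    p * (length (pairsSumming m) * length rest)
      ≡⟨ cong (λ c → p * (c * length rest)) (length-pairsSumming m) ⟩
    p * (suc m * length rest)
      ≡⟨ reassociate p m (length rest) ⟩
    (p * (m + 1)) * length rest
      ≡⟨ count-profiles j _ (p * (m + 1)) ⟩
    inner (suc j) (r ∸ suc (suc j) * m) (p * (m + 1))
      ∎
    where
    rest = profiles j (r ∸ suc (suc j) * m)
    reassociate : ∀ p m l → p * (suc m * l) ≡ (p * (m + 1)) * l
    reassociate = solve-∀

-- The head pair of a profile and its sum, used as keys telling the pieces of
-- profiles apart (the value on the empty profile is never consulted).
headPair : Profile → ℕ × ℕ
headPair []        = 0 , 0
headPair (ab ∷ _)  = ab

headSum : Profile → ℕ
headSum ps = proj₁ (headPair ps) + proj₂ (headPair ps)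

-- No profile is listed twice: pieces with different head sums, and within them
-- pieces with different head pairs, are disjoint.
Unique-profiles : ∀ j r → Unique (profiles j r)
Unique-profiles zero    r = Unique.map⁺ (λ { refl → refl }) (Unique-pairsSumming r)
Unique-profiles (suc j) r =
  Unique-concatMap (profilesWithHead j r) headSum headSumKey uniqueWithHead (Unique.upTo⁺ (suc (r / suc (suc j))))
  where
  rest : ℕ → List Profile
  rest m = profiles j (r ∸ suc (suc j) * m)
  headPairKey : ∀ m ab {ps} → ps ∈ map (ab ∷_) (rest m) → headPair ps ≡ ab
  headPairKey m ab ps∈ with map∷⁻ ps∈
  ... | _ , _ , refl = refl
  uniqueWithHead : ∀ m → Unique (profilesWithHead j r m)
  uniqueWithHead m = Unique-concatMap (λ ab → map (ab ∷_) (rest m)) headPair (headPairKey m)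
    (λ ab → Unique.map⁺ (λ { refl → refl }) (Unique-profiles j _)) (Unique-pairsSumming m)
  headSumKey : ∀ m {ps} → ps ∈ profilesWithHead j r m → headSum ps ≡ m
  headSumKey m ps∈ with find (∈-concatMap⁻ _ {pairsSumming m} ps∈)
  ... | ab , ab∈ , ps∈′ rewrite headPairKey m ab ps∈′ = ∈-pairsSumming⁻ ab∈

≤/⇒*≤ : ∀ {m r} d .{{_ : NonZero d}} → m ≤ r / d → m * d ≤ r
≤/⇒*≤ {m} {r} d m≤ = ≤-trans (*-monoˡ-≤ d m≤) (m/n*n≤m r d)

*≤⇒≤/ : ∀ {m r} d .{{_ : NonZero d}} → m * d ≤ r → m ≤ r / d
*≤⇒≤/ {m} {r} d m*d≤ = subst (_≤ r / d) (m*n/n≡m m d) (/-monoˡ-≤ d m*d≤)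

peelHead : ∀ {m r} d .{{_ : NonZero d}} → m ≤ r / d → m * d + (r ∸ d * m) ≡ r
peelHead {m} {r} d m≤ rewrite *-comm d m = m+[n∸m]≡n (≤/⇒*≤ d m≤)

∈-profiles⁻ : ∀ j r {ps} → ps ∈ profiles j r → length ps ≡ suc j × weight ps ≡ r
∈-profiles⁻ zero r ps∈ with ∈-map⁻ [_] ps∈
... | (a , b) , ab∈ , refl =
  refl , trans (+-identityʳ _) (trans (*-identityʳ (a + b)) (∈-pairsSumming⁻ ab∈))
∈-profiles⁻ (suc j) r ps∈
  with find (∈-concatMap⁻ (profilesWithHead j r) {upTo (suc (r / suc (suc j)))} ps∈)
... | m , m∈ , ps∈′ with find (∈-concatMap⁻ _ {pairsSumming m} ps∈′)
... | (a , b) , ab∈ , ps∈″ with map∷⁻ ps∈″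
... | qs , qs∈ , refl with ∈-profiles⁻ j _ qs∈
... | lq , wq = cong suc lq , weightEq
  where
  weightEq : (a + b) * suc (length qs) + weight qs ≡ r
  weightEq rewrite lq | wq | ∈-pairsSumming⁻ ab∈ = peelHead (suc (suc j)) (≤-pred (∈-upTo⁻ m∈))

∈-profiles⁺ : ∀ j r {ps} → length ps ≡ suc j → weight ps ≡ r → ps ∈ profiles j r
∈-profiles⁺ zero r {(a , b) ∷ []} refl w =
  subst (λ s → [ (a , b) ] ∈ profiles zero s) abEq (∈-map⁺ [_] (∈-pairsSumming⁺ a b))
  where
  abEq : a + b ≡ r
  abEq = trans (sym (trans (+-identityʳ _) (*-identityʳ (a + b)))) w
∈-profiles⁺ (suc j) r {(a , b) ∷ qs} lps w =
  ∈-concatMap⁺ (profilesWithHead j r) (lose (∈-upTo⁺ (s≤s m≤))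
    (∈-concatMap⁺ _ (lose (∈-pairsSumming⁺ a b) (∈-map⁺ ((a , b) ∷_) (∈-profiles⁺ j _ lq wq)))))
  where
  d = suc (suc j)
  lq : length qs ≡ suc j
  lq = suc-injective lps
  w′ : (a + b) * d + weight qs ≡ r
  w′ = subst (λ l → (a + b) * suc l + weight qs ≡ r) lq w
  m≤ : a + b ≤ r / d
  m≤ = *≤⇒≤/ d (≤-trans (m≤m+n _ (weight qs)) (≤-reflexive w′))
  wq : weight qs ≡ r ∸ d * (a + b)
  wq = trans (sym (m+n∸m≡n ((a + b) * d) (weight qs))) (cong₂ _∸_ w′ (*-comm (a + b) d))

Nonincreasing : List ℕ → Set
Nonincreasing = Linked _≥_

≤-head : ∀ {x xs} → Nonincreasing (x ∷ xs) → All (_≤ x) xs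
≤-head [-]          = []
≤-head (x≥y ∷ rest) = Linked.Linked⇒All (λ x≥y y≥z → ≤-trans y≥z x≥y) x≥y rest

++-nonincreasing : ∀ c {P T} → Nonincreasing P → All (c ≤_) P → All (_≤ c) T →
  Nonincreasing T → Nonincreasing (P ++ T)
++-nonincreasing c {[]}         _           _          _           nT = nT
++-nonincreasing c {x ∷ []} {[]}    _       _          _           _  = [-]
++-nonincreasing c {x ∷ []} {y ∷ T} _       (c≤x ∷ []) (y≤c ∷ _)   nT = ≤-trans y≤c c≤x ∷ nT
++-nonincreasing c {x ∷ y ∷ P} (x≥y ∷ nP) (_ ∷ c≤P)  T≤c         nT =
  x≥y ∷ ++-nonincreasing c nP c≤P T≤c nT

++-nonincreasing⁻ˡ : ∀ P {T} → Nonincreasing (P ++ T) → Nonincreasing P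
++-nonincreasing⁻ˡ []          _          = []
++-nonincreasing⁻ˡ (x ∷ [])    _          = [-]
++-nonincreasing⁻ˡ (x ∷ y ∷ P) (x≥y ∷ nP) = x≥y ∷ ++-nonincreasing⁻ˡ (y ∷ P) nP

++-nonincreasing⁻ʳ : ∀ P {T} → Nonincreasing (P ++ T) → Nonincreasing T
++-nonincreasing⁻ʳ []      nT = nT
++-nonincreasing⁻ʳ (x ∷ P) nP = ++-nonincreasing⁻ʳ P (Linked.tail nP)

∷ʳ-nonincreasing⁻ : ∀ X {a} → Nonincreasing (X ++ [ a ]) → Nonincreasing X × All (a ≤_) X
∷ʳ-nonincreasing⁻ []          _            = [] , []
∷ʳ-nonincreasing⁻ (x ∷ [])    (x≥a ∷ _)    = [-] , (x≥a ∷ [])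
∷ʳ-nonincreasing⁻ (x ∷ y ∷ X) (x≥y ∷ nyX) with ∷ʳ-nonincreasing⁻ (y ∷ X) nyX
... | nX , (y≥a ∷ X≥a) = (x≥y ∷ nX) , (≤-trans y≥a x≥y ∷ y≥a ∷ X≥a)

map-+-nonincreasing : ∀ a {xs} → Nonincreasing xs → Nonincreasing (map (a +_) xs)
map-+-nonincreasing a nxs = Linked.map⁺ (Linked.map (+-monoʳ-≤ a) nxs)

map-∸-nonincreasing : ∀ a {xs} → Nonincreasing xs → Nonincreasing (map (_∸ a) xs)
map-∸-nonincreasing a nxs = Linked.map⁺ (Linked.map (∸-monoˡ-≤ a) nxs)

replicate-nonincreasing : ∀ b d → Nonincreasing (replicate b d)
replicate-nonincreasing zero          d = []
replicate-nonincreasing (suc zero)    d = [-]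
replicate-nonincreasing (suc (suc b)) d = ≤-refl ∷ replicate-nonincreasing (suc b) d

splitLeading : ∀ d t → Nonincreasing t → All (_≤ d) t →
  ∃[ b ] ∃[ t′ ] (t ≡ replicate b d ++ t′ × All (_< d) t′)
splitLeading d []       _   _          = 0 , [] , refl , []
splitLeading d (x ∷ xs) nxs (x≤d ∷ xs≤d) with x ≟ d
... | yes refl with splitLeading d xs (Linked.tail nxs) xs≤d
...   | b , t′ , refl , t′<d = suc b , t′ , refl , t′<d
splitLeading d (x ∷ xs) nxs (x≤d ∷ _) | no x≢d =
  0 , x ∷ xs , refl , (x<d ∷ All.map (λ y≤x → ≤-<-trans y≤x x<d) (≤-head nxs))
  where x<d = ≤∧≢⇒< x≤d x≢d

splitAtLength : ∀ {A : Set} k (xs : List A) → k ≤ length xs →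
  ∃[ P ] ∃[ T ] (length P ≡ k × xs ≡ P ++ T)
splitAtLength zero    xs       _        = [] , xs , refl , refl
splitAtLength (suc k) (x ∷ xs) (s≤s k≤) with splitAtLength k xs k≤
... | P , T , refl , refl = x ∷ P , T , refl , refl

initLast : ∀ {A : Set} (h : List A) j → length h ≡ suc j →
  ∃[ X ] ∃[ a ] (h ≡ X ++ [ a ] × length X ≡ j)
initLast (x ∷ [])    zero    refl = [] , x , refl , refl
initLast (x ∷ y ∷ h) (suc j) lh with initLast (y ∷ h) j (suc-injective lh)
... | X , a , h≡ , refl = x ∷ X , a , cong (x ∷_) h≡ , refl

part-≤ : ∀ c xs → All (_≤ c) xs → ∀ i → part xs i ≤ c
part-≤ c []       _           i             = z≤n
part-≤ c (x ∷ xs) _           zero          = z≤n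
part-≤ c (x ∷ xs) (x≤c ∷ _)   (suc zero)    = x≤c
part-≤ c (x ∷ xs) (_ ∷ xs≤c)  (suc (suc i)) = part-≤ c xs xs≤c (suc i)

part-++ˡ : ∀ c P t i → All (c ≤_) P → suc i ≤ length P → c ≤ part (P ++ t) (suc i)
part-++ˡ c (x ∷ P) t zero    (c≤x ∷ _)  _        = c≤x
part-++ˡ c (x ∷ P) t (suc i) (_ ∷ c≤P) (s≤s i<) = part-++ˡ c P t i c≤P i<

part-++ʳ : ∀ P t j → length P < j → part (P ++ t) j ≡ part t (j ∸ length P)
part-++ʳ []      t j             _         = refl
part-++ʳ (x ∷ P) t (suc (suc j)) (s≤s P<j) = part-++ʳ P t (suc j) P<j

part-length : ∀ xs i → 1 ≤ part xs (suc i) → suc i ≤ length xs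
part-length (x ∷ xs) zero    _   = s≤s z≤n
part-length (x ∷ xs) (suc i) pos = s≤s (part-length xs i pos)

part-lowerBound : ∀ P {T} → Nonincreasing (P ++ T) → ∀ {i} → length P ≡ suc i →
  All (part (P ++ T) (suc i) ≤_) P
part-lowerBound (x ∷ [])    _          refl = ≤-refl ∷ []
part-lowerBound (x ∷ y ∷ P) (x≥y ∷ nP) refl with part-lowerBound (y ∷ P) nP refl
... | λ≤y ∷ λ≤P = ≤-trans λ≤y x≥y ∷ λ≤y ∷ λ≤P

-- the rows to the right of the square, row i being a_i + … + a_j (so a_i
-- counts the columns of height i there);
rightRows : Profile → List ℕ
rightRows []             = []
rightRows ((a , b) ∷ ps) = map (a +_) (rightRows ps) ++ [ a ]

belowRows : Profile → List ℕ
belowRows []             = []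
belowRows ((a , b) ∷ ps) = replicate b (suc (length ps)) ++ belowRows ps

assemble : ℕ → Profile → List ℕ
assemble k ps = map (k +_) (rightRows ps) ++ belowRows ps

length-rightRows : ∀ ps → length (rightRows ps) ≡ length ps
length-rightRows []             = refl
length-rightRows ((a , b) ∷ ps) = begin
  length (map (a +_) (rightRows ps) ++ [ a ]) ≡⟨ length-++ (map (a +_) (rightRows ps)) ⟩
  length (map (a +_) (rightRows ps)) + 1      ≡⟨ +-comm _ 1 ⟩
  suc (length (map (a +_) (rightRows ps)))    ≡⟨ cong suc (length-map (a +_) (rightRows ps)) ⟩
  suc (length (rightRows ps))                 ≡⟨ cong suc (length-rightRows ps) ⟩
  suc (length ps)                             ∎
  where open ≡-Reasoning

length-shiftedRows : ∀ k ps → length (map (k +_) (rightRows ps)) ≡ length ps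
length-shiftedRows k ps = trans (length-map (k +_) (rightRows ps)) (length-rightRows ps)

map-+-≥ : ∀ a xs → All (a ≤_) (map (a +_) xs)
map-+-≥ a []       = []
map-+-≥ a (x ∷ xs) = m≤m+n a x ∷ map-+-≥ a xs

map-+-∸ : ∀ a xs → All (a ≤_) xs → map (a +_) (map (_∸ a) xs) ≡ xs
map-+-∸ a []       _            = refl
map-+-∸ a (x ∷ xs) (a≤x ∷ a≤xs) = cong₂ _∷_ (m+[n∸m]≡n a≤x) (map-+-∸ a xs a≤xs)

rightRows-nonincreasing : ∀ ps → Nonincreasing (rightRows ps)
rightRows-nonincreasing []             = []
rightRows-nonincreasing ((a , b) ∷ ps) =
  ++-nonincreasing a (map-+-nonincreasing a (rightRows-nonincreasing ps)) (map-+-≥ a (rightRows ps))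
    (≤-refl ∷ []) [-]

belowRows-positive : ∀ ps → All (1 ≤_) (belowRows ps)
belowRows-positive []             = []
belowRows-positive ((a , b) ∷ ps) = All.++⁺ (All.replicate⁺ b (s≤s z≤n)) (belowRows-positive ps)

belowRows-≤ : ∀ ps → All (_≤ length ps) (belowRows ps)
belowRows-≤ []             = []
belowRows-≤ ((a , b) ∷ ps) =
  All.++⁺ (All.replicate⁺ b ≤-refl) (All.map m≤n⇒m≤1+n (belowRows-≤ ps))

belowRows-< : ∀ ps {l} → length ps ≡ l → All (_< suc l) (belowRows ps)
belowRows-< ps refl = All.map s≤s (belowRows-≤ ps)

belowRows-nonincreasing : ∀ ps → Nonincreasing (belowRows ps)
belowRows-nonincreasing []             = []
belowRows-nonincreasing ((a , b) ∷ ps) =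
  ++-nonincreasing (suc (length ps)) (replicate-nonincreasing b _) (All.replicate⁺ b ≤-refl)
    (All.map m≤n⇒m≤1+n (belowRows-≤ ps)) (belowRows-nonincreasing ps)

sum-map-+ : ∀ a xs → sum (map (a +_) xs) ≡ length xs * a + sum xs
sum-map-+ a []       = refl
sum-map-+ a (x ∷ xs) = trans (cong ((a + x) +_) (sum-map-+ a xs)) (regroup (length xs * a) a x (sum xs))
  where
  regroup : ∀ p a x s → (a + x) + (p + s) ≡ (a + p) + (x + s)
  regroup = solve-∀

sum-replicate : ∀ b d → sum (replicate b d) ≡ b * d
sum-replicate zero    d = refl
sum-replicate (suc b) d = cong (d +_) (sum-replicate b d)

sum-rows : ∀ ps → sum (rightRows ps) + sum (belowRows ps) ≡ weight ps
sum-rows []             = refl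
sum-rows ((a , b) ∷ ps) = begin
  sum (map (a +_) R ++ [ a ]) + sum (replicate b (suc L) ++ B)
    ≡⟨ cong₂ _+_ (sum-++ (map (a +_) R) [ a ]) (sum-++ (replicate b (suc L)) B) ⟩
  (sum (map (a +_) R) + (a + 0)) + (sum (replicate b (suc L)) + sum B)
    ≡⟨ cong₂ (λ u v → (u + (a + 0)) + (v + sum B))
         (trans (sum-map-+ a R) (cong (λ l → l * a + sum R) (length-rightRows ps)))
         (sum-replicate b (suc L)) ⟩
  ((L * a + sum R) + (a + 0)) + (b * suc L + sum B)
    ≡⟨ regroup L a b (sum R) (sum B) ⟩
  (a + b) * suc L + (sum R + sum B)
    ≡⟨ cong ((a + b) * suc L +_) (sum-rows ps) ⟩
  (a + b) * suc L + weight ps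
    ∎
  where
  open ≡-Reasoning
  L = length ps
  R = rightRows ps
  B = belowRows ps
  regroup : ∀ L a b r s → ((L * a + r) + (a + 0)) + (b * suc L + s) ≡ (a + b) * suc L + (r + s)
  regroup = solve-∀

sum-assemble : ∀ k ps → length ps ≡ k → sum (assemble k ps) ≡ k * k + weight ps
sum-assemble k ps lps = begin
  sum (map (k +_) R ++ belowRows ps)                  ≡⟨ sum-++ (map (k +_) R) (belowRows ps) ⟩
  sum (map (k +_) R) + sum (belowRows ps)             ≡⟨ cong (_+ sum (belowRows ps)) (sum-map-+ k R) ⟩
  (length R * k + sum R) + sum (belowRows ps)         ≡⟨ +-assoc (length R * k) _ _ ⟩
  length R * k + (sum R + sum (belowRows ps))         ≡⟨ cong₂ _+_ (cong (_* k) (trans (length-rightRows ps) lps))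
                                                                   (sum-rows ps) ⟩
  k * k + weight ps                                   ∎
  where
  open ≡-Reasoning
  R = rightRows ps

assemble-partition : ∀ k ps → length ps ≡ suc k →
  IsPartition (suc k * suc k + weight ps) (assemble (suc k) ps)
assemble-partition k ps lps = positive , nonincreasing , sum-assemble (suc k) ps lps
  where
  positive : All (1 ≤_) (assemble (suc k) ps)
  positive = All.++⁺ (All.map (≤-trans (s≤s z≤n)) (map-+-≥ (suc k) (rightRows ps))) (belowRows-positive ps)
  nonincreasing : Nonincreasing (assemble (suc k) ps)
  nonincreasing = ++-nonincreasing (suc k) (map-+-nonincreasing (suc k) (rightRows-nonincreasing ps))
    (map-+-≥ (suc k) (rightRows ps)) (subst (λ l → All (_≤ l) (belowRows ps)) lps (belowRows-≤ ps))
    (belowRows-nonincreasing ps)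

assemble-durfee : ∀ k ps → length ps ≡ suc k → DurfeeOrder (assemble (suc k) ps) (suc k)
assemble-durfee k ps lps = inj₂ squareFits , beyondSquare
  where
  P = map (suc k +_) (rightRows ps)
  lP : length P ≡ suc k
  lP = trans (length-shiftedRows (suc k) ps) lps
  squareFits : suc k ≤ part (P ++ belowRows ps) (suc k)
  squareFits = part-++ˡ (suc k) P (belowRows ps) k (map-+-≥ (suc k) (rightRows ps)) (≤-reflexive (sym lP))
  beyondSquare : ∀ j → suc k < j → part (P ++ belowRows ps) j < j
  beyondSquare j k<j = begin-strict
    part (P ++ belowRows ps) j               ≡⟨ part-++ʳ P (belowRows ps) j (subst (_< j) (sym lP) k<j) ⟩
    part (belowRows ps) (j ∸ length P)       ≤⟨ part-≤ (length ps) (belowRows ps) (belowRows-≤ ps) _ ⟩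
    length ps                                ≡⟨ lps ⟩
    suc k                                    <⟨ k<j ⟩
    j                                        ∎
    where open ≤-Reasoning

replicate-++-injective : ∀ d b b′ {T T′} → All (_< d) T → All (_< d) T′ →
  replicate b d ++ T ≡ replicate b′ d ++ T′ → b ≡ b′ × T ≡ T′
replicate-++-injective d zero    zero     _           _           eq = refl , eq
replicate-++-injective d (suc b) zero     _           (y<d ∷ _)   refl = contradiction y<d (<-irrefl refl)
replicate-++-injective d zero    (suc b′) (y<d ∷ _)   _           refl = contradiction y<d (<-irrefl refl)
replicate-++-injective d (suc b) (suc b′) T<d         T′<d        eq
  with replicate-++-injective d b b′ T<d T′<d (∷-injectiveʳ eq)
... | refl , T≡T′ = refl , T≡T′

++-injective : ∀ {A : Set} (xs ys : List A) {zs ws} → length xs ≡ length ys →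
  xs ++ zs ≡ ys ++ ws → xs ≡ ys × zs ≡ ws
++-injective []       []       _   eq = refl , eq
++-injective (x ∷ xs) (y ∷ ys) lxs eq with ∷-injective eq
... | refl , eq′ with ++-injective xs ys (suc-injective lxs) eq′
... | refl , zs≡ws = refl , zs≡ws

-- The last row beside the square gives a_j, the block of rows of length j below
-- it gives b_j, and the rest is the shorter profile.
rows-injective : ∀ ps qs → length ps ≡ length qs → rightRows ps ≡ rightRows qs →
  belowRows ps ≡ belowRows qs → ps ≡ qs
rows-injective []             []               _   _  _  = refl
rows-injective ((a , b) ∷ ps) ((a′ , b′) ∷ qs) lps eR eB
  with ∷ʳ-injective (map (a +_) (rightRows ps)) (map (a′ +_) (rightRows qs)) eR
... | eR′ , refl
  with replicate-++-injective (suc (length ps)) b b′ (belowRows-< ps refl) (belowRows-< qs (sym (suc-injective lps)))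
         (subst (λ l → replicate b (suc (length ps)) ++ belowRows ps ≡ replicate b′ (suc l) ++ belowRows qs)
                (sym (suc-injective lps)) eB)
... | refl , eB′ =
  cong ((a , b) ∷_) (rows-injective ps qs (suc-injective lps) (map-injective (+-cancelˡ-≡ a _ _) eR′) eB′)

assemble-injective : ∀ k ps qs → length ps ≡ length qs → assemble k ps ≡ assemble k qs → ps ≡ qs
assemble-injective k ps qs lps eq
  with ++-injective (map (k +_) (rightRows ps)) (map (k +_) (rightRows qs))
         (trans (length-shiftedRows k ps) (trans lps (sym (length-shiftedRows k qs)))) eq
... | eR , eB = rows-injective ps qs lps (map-injective (+-cancelˡ-≡ k _ _) eR) eB

-- The last entry of h is a_j and the number of leading j's in t is b_j.
rows-surjective : ∀ j h t → length h ≡ j → Nonincreasing h → Nonincreasing t →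
  All (1 ≤_) t → All (_≤ j) t → ∃[ ps ] (length ps ≡ j × rightRows ps ≡ h × belowRows ps ≡ t)
rows-surjective zero [] []      _ _ _ _            _           = [] , refl , refl , refl
rows-surjective zero [] (y ∷ t) _ _ _ (1≤y ∷ _) (y≤0 ∷ _) = contradiction (≤-trans 1≤y y≤0) λ ()
rows-surjective (suc j) h t lh nh nt t≥1 t≤j
  with initLast h j lh
... | X , a , refl , lX
  with ∷ʳ-nonincreasing⁻ X nh | splitLeading (suc j) t nt t≤j
... | nX , X≥a | b , t′ , refl , t′<j
  with rows-surjective j (map (_∸ a) X) t′ (trans (length-map (_∸ a) X) lX) (map-∸-nonincreasing a nX)
         (++-nonincreasing⁻ʳ (replicate b (suc j)) nt) (All.++⁻ʳ (replicate b (suc j)) t≥1)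
         (All.map ≤-pred t′<j)
... | ps , lps , rps , bps =
  (a , b) ∷ ps , cong suc lps ,
  cong (_++ [ a ]) (trans (cong (map (a +_)) rps) (map-+-∸ a X X≥a)) ,
  cong₂ (λ l r → replicate b (suc l) ++ r) lps bps

part₁-bound : ∀ c t → Nonincreasing t → part t 1 ≤ c → All (_≤ c) t
part₁-bound c []       _   _   = []
part₁-bound c (y ∷ ys) nys y≤c = y≤c ∷ All.map (λ z≤y → ≤-trans z≤y y≤c) (≤-head nys)

assemble-surjective : ∀ n k λs → IsPartition n λs → DurfeeOrder λs (suc k) →
  ∃[ ps ] (length ps ≡ suc k × assemble (suc k) ps ≡ λs)
assemble-surjective n k λs (λs≥1 , nλs , _) (inj₂ k≤λₖ , beyond)
  with splitAtLength (suc k) λs (part-length λs k (≤-trans (s≤s z≤n) k≤λₖ))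
... | P , T , lP , refl
  with rows-surjective (suc k) (map (_∸ suc k) P) T (trans (length-map (_∸ suc k) P) lP)
         (map-∸-nonincreasing (suc k) (++-nonincreasing⁻ˡ P nλs)) (++-nonincreasing⁻ʳ P nλs)
         (All.++⁻ʳ P λs≥1) (part₁-bound (suc k) T (++-nonincreasing⁻ʳ P nλs) T₁≤k)
  where
  -- the first row below the square, λ_{k+2}, is shorter than k + 2
  T₁≤k : part T 1 ≤ suc k
  T₁≤k = ≤-pred (subst (_< suc (suc k)) firstBelow (beyond (suc (suc k)) ≤-refl))
    where
    firstBelow : part (P ++ T) (suc (suc k)) ≡ part T 1
    firstBelow = trans (part-++ʳ P T (suc (suc k)) (subst (_< suc (suc k)) (sym lP) ≤-refl))
                       (cong (part T) (trans (cong (suc (suc k) ∸_) lP) (m+n∸n≡m 1 (suc k))))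
... | ps , lps , rps , bps = ps , lps , cong₂ _++_ (trans (cong (map (suc k +_)) rps) (map-+-∸ (suc k) P P≥k)) bps
  where
  -- the rows of the square are at least λ_{k+1} ≥ k + 1
  P≥k : All (suc k ≤_) P
  P≥k = All.map (≤-trans k≤λₖ) (part-lowerBound P nλs lP)

assembled-size : ∀ n k ps → length ps ≡ suc k → IsPartition n (assemble (suc k) ps) →
  suc k * suc k + weight ps ≡ n
assembled-size n k ps lps (_ , _ , sum≡n) = trans (sym (sum-assemble (suc k) ps lps)) sum≡n

durfeeSquare-fits : ∀ n k λs → IsPartition n λs → DurfeeOrder λs (suc k) → suc k * suc k ≤ n
durfeeSquare-fits n k λs isPart durfee with assemble-surjective n k λs isPart durfee
... | ps , lps , refl = subst (suc k * suc k ≤_) (assembled-size n k ps lps isPart) (m≤m+n _ (weight ps))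

durfeePartitions : ℕ → ℕ → List (List ℕ)
durfeePartitions n k = map (assemble (suc k)) (profiles k (n ∸ suc k * suc k))

Unique-durfeePartitions : ∀ n k → Unique (durfeePartitions n k)
Unique-durfeePartitions n k = Unique-map-on (assemble (suc k)) (Unique-profiles k _) sameLength⇒equal
  where
  sameLength⇒equal : ∀ {ps qs} → ps ∈ profiles k _ → qs ∈ profiles k _ →
    assemble (suc k) ps ≡ assemble (suc k) qs → ps ≡ qs
  sameLength⇒equal ps∈ qs∈ =
    assemble-injective (suc k) _ _
      (trans (proj₁ (∈-profiles⁻ k _ ps∈)) (sym (proj₁ (∈-profiles⁻ k _ qs∈))))

∈-durfeePartitions : ∀ n k → suc k * suc k ≤ n → ∀ λs →
  λs ∈ durfeePartitions n k ⇔ (IsPartition n λs × DurfeeOrder λs (suc k))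
∈-durfeePartitions n k kk≤n λs = mk⇔ listed⇒durfee durfee⇒listed
  where
  r = n ∸ suc k * suc k
  listed⇒durfee : λs ∈ durfeePartitions n k → IsPartition n λs × DurfeeOrder λs (suc k)
  listed⇒durfee λs∈ with ∈-map⁻ (assemble (suc k)) λs∈
  ... | ps , ps∈ , refl with ∈-profiles⁻ k r ps∈
  ... | lps , wps =
    subst (λ m → IsPartition m (assemble (suc k) ps)) size (assemble-partition k ps lps) ,
    assemble-durfee k ps lps
    where
    size : suc k * suc k + weight ps ≡ n
    size = trans (cong (suc k * suc k +_) wps) (m+[n∸m]≡n kk≤n)
  durfee⇒listed : IsPartition n λs × DurfeeOrder λs (suc k) → λs ∈ durfeePartitions n k
  durfee⇒listed (isPart , durfee) with assemble-surjective n k λs isPart durfee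
  ... | ps , lps , refl = ∈-map⁺ (assemble (suc k)) (∈-profiles⁺ k r {ps} lps wps)
    where
    wps : weight ps ≡ r
    wps = trans (sym (m+n∸m≡n (suc k * suc k) (weight ps)))
                (cong (_∸ suc k * suc k) (assembled-size n k ps lps isPart))

length-durfeePartitions : ∀ n k → length (durfeePartitions n k) ≡ inner (suc k) (n ∸ suc k * suc k) 1
length-durfeePartitions n k =
  trans (length-map (assemble (suc k)) (profiles k r)) (trans (sym (*-identityˡ _)) (count-profiles k r 1))
  where r = n ∸ suc k * suc k

mainTheorem2 : (n k : ℕ) → 1 ≤ k →
    ∃[ L ] (Unique L
           × (∀ (λs : List ℕ) → (λs ∈ L) ⇔ (IsPartition n λs × DurfeeOrder λs k))
           × length L ≡ durfeeFormula n k)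
mainTheorem2 n (suc k) _ with suc k * suc k ≤? n
... | yes kk≤n = durfeePartitions n k , Unique-durfeePartitions n k , ∈-durfeePartitions n k kk≤n ,
                 length-durfeePartitions n k
... | no kk≰n  = [] , [] , (λ λs → mk⇔ (λ ()) noPartition) , refl
  where
  noPartition : ∀ {λs} → IsPartition n λs × DurfeeOrder λs (suc k) → λs ∈ []
  noPartition {λs} (isPart , durfee) = contradiction (durfeeSquare-fits n k λs isPart durfee) kk≰n
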